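{- Let $G$ be a finite simple graph and $f_1, f_2 : G \to \mathbb{R}$ (excellent) discrete Morse functions. Let $\tilde{v}_1$ be a $0$-dimensional critical simplex of $f_1$ and $\tilde{v}_2$ a $0$-dimensional critical simplex of $f_2$. If $\tilde{v}_1$ is strongly connected to $\tilde{v}_2$, then $\tilde{v}_1$ is not strongly connected to any other $f_2$-critical simplex, and $\tilde{v}_2$ is not strongly connected to any other $f_1$-critical simplex. Moreover, the gradient path connecting $\tilde{v}_1$ to $\tilde{v}_2$ and the gradient path connecting $\tilde{v}_2$ to $\tilde{v}_1$ are unique.
   Context: A simple graph is regarded as a 1-dimensional simplicial complex; $v \prec e$ means $v$ is an endpoint of $e$. A discrete Morse function on $G$ is $f: G \to \mathbb{R}$ on vertices and edges such that each vertex $v$ has at most one incident edge $e$ with $f(e) \le f(v)$, and each edge $e$ has at most one endpoint $v$ with $f(e) \le f(v)$. A simplex is critical if no such edge (for a vertex) or endpoint (for an edge) exists; $f$ is excellent if critical values are distinct. The gradient vector field $V$ of $f$ is the set of pairs $(v,e)$ with $v \prec e$ and $f(v)\ge f(e)$. A $V$-path from a vertex $v_0$ to a vertex $v_{r+1}$ is a sequence $v_0, e_0, v_1, \ldots, e_r, v_{r+1}$ with $(v_i, e_i) \in V$, $v_{i+1} \prec e_i$, $v_{i+1} \ne v_i$; a single vertex is a trivial path. Let $V_1,V_2$ be the gradient vector fields of $f_1,f_2$. For an $f_1$-critical vertex $v_1$ and an $f_2$-critical vertex $v_2$: $v_1$ is connected to $v_2$ if there is a $V_2$-path from $v_1$ to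 $v_2$ (the gradient path connecting $v_1$ to $v_2$), and $v_2$ is connected to $v_1$ if there is a $V_1$-path from $v_2$ to $v_1$. They are strongly connected if each is connected to the other (a vertex critical for both functions is strongly connected to itself via the trivial path). Only simplices of equal dimension can be (strongly) connected. -}

module Defs where

open import Level using (Level; _⊔_)
open import Data.Nat using (ℕ)
open import Data.Fin using (Fin)
open import Data.Sum using (_⊎_; inj₁; inj₂)
open import Data.Product using (Σ; _×_; _,_; ∃)
open import Data.List using (List; []; _∷_)
open import Relation.Nullary using (¬_)
open import Relation.Binary.PropositionalEquality using (_≡_; _≢_)
open import Relation.Binary.Bundles using (TotalOrder)

record SimpleGraph : Set where
  field
    nV    : ℕ
    nE    : ℕ
    end₁  : Fin nE → Fin nV
    end₂  : Fin nE → Fin nV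
    loopless : ∀ e → end₁ e ≢ end₂ e
    noMulti  : ∀ e e' →
      ((end₁ e ≡ end₁ e' × end₂ e ≡ end₂ e') ⊎ (end₁ e ≡ end₂ e' × end₂ e ≡ end₁ e')) →
      e ≡ e'

  Vertex : Set
  Vertex = Fin nV

  Edge : Set
  Edge = Fin nE

  _≺_ : Vertex → Edge → Set
  v ≺ e = (v ≡ end₁ e) ⊎ (v ≡ end₂ e)

  Simplex : Set
  Simplex = Vertex ⊎ Edge

module _ {a ℓ₁ ℓ₂ : Level} (O : TotalOrder a ℓ₁ ℓ₂) (G : SimpleGraph) where
  open TotalOrder O renaming (Carrier to R)
  open SimpleGraph G

  record GraphFunction : Set a where
    field
      fV : Vertex → R
      fE : Edge → R

  module _ (f : GraphFunction) where
    open GraphFunction f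

    value : Simplex → R
    value (inj₁ v) = fV v
    value (inj₂ e) = fE e

    IsDiscreteMorse : Set ℓ₂
    IsDiscreteMorse =
      (∀ v e e' → v ≺ e → v ≺ e' → fE e ≤ fV v → fE e' ≤ fV v → e ≡ e')
      × (∀ e v w → v ≺ e → w ≺ e → fE e ≤ fV v → fE e ≤ fV w → v ≡ w)

    CriticalVertex : Vertex → Set (ℓ₂)
    CriticalVertex v = ∀ e → v ≺ e → ¬ (fE e ≤ fV v)

    CriticalEdge : Edge → Set (ℓ₂)
    CriticalEdge e = ∀ v → v ≺ e → ¬ (fE e ≤ fV v)

    Critical : Simplex → Set ℓ₂
    Critical (inj₁ v) = CriticalVertex v
    Critical (inj₂ e) = CriticalEdge e

    IsExcellent : Set (ℓ₁ ⊔ ℓ₂)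
    IsExcellent = ∀ σ τ → Critical σ → Critical τ → value σ ≈ value τ → σ ≡ τ

    InV : Vertex → Edge → Set ℓ₂
    InV v e = v ≺ e × fE e ≤ fV v

    -- A V-path v₀, e₀, v₁, …, e_r, v_{r+1}, encoded by its start vertex v₀
    -- and the list of steps ((e₀ , v₁) ∷ … ∷ (e_r , v_{r+1}) ∷ []).
    IsVPath : Vertex → List (Edge × Vertex) → Vertex → Set ℓ₂
    IsVPath v₀ []               w = Level.Lift ℓ₂ (v₀ ≡ w)
    IsVPath v₀ ((e , v₁) ∷ ps) w = InV v₀ e × v₁ ≺ e × v₁ ≢ v₀ × IsVPath v₁ ps w

    VPathExists : Vertex → Vertex → Set ℓ₂
    VPathExists v w = ∃ λ ps → IsVPath v ps w

    UniqueVPath : Vertex → Vertex → Set ℓ₂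
    UniqueVPath v w = ∀ ps qs → IsVPath v ps w → IsVPath v qs w → ps ≡ qs

  StronglyConnected : (f₁ f₂ : GraphFunction) → Vertex → Vertex → Set ℓ₂
  StronglyConnected f₁ f₂ v₁ v₂ = VPathExists f₂ v₁ v₂ × VPathExists f₁ v₂ v₁

{-# OPTIONS --safe #-}
module Submission where

-- A gradient vector field pairs each vertex with at most one edge, and the
-- other endpoint of that edge is determined, so a V-path has at most one way
-- to continue from each vertex; at a critical vertex it cannot continue at
-- all. Hence a V-path that starts at v and ends at a critical vertex is
-- determined by v, endpoint included. Applied to the two V-paths of a strong
-- connection this yields all four claims.

open import Defs
open import Level using (Level; lift)
open import Data.Sum using (inj₁; inj₂)
open import Data.Product using (_×_; _,_; proj₁; proj₂)
open import Data.List using (List; []; _∷_)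
open import Data.Empty using (⊥-elim)
open import Relation.Binary.PropositionalEquality using (_≡_; _≢_; refl; sym; trans)
open import Relation.Binary.Bundles using (TotalOrder)

module _ (G : SimpleGraph) where
  open SimpleGraph G

  other-endpoint-unique : ∀ {e v x y} → v ≺ e →
    x ≺ e → x ≢ v → y ≺ e → y ≢ v → x ≡ y
  other-endpoint-unique _        (inj₁ x≡) _   (inj₁ y≡) _   = trans x≡ (sym y≡)
  other-endpoint-unique _        (inj₂ x≡) _   (inj₂ y≡) _   = trans x≡ (sym y≡)
  other-endpoint-unique (inj₁ v≡) (inj₁ x≡) x≢v _        _   = ⊥-elim (x≢v (trans x≡ (sym v≡)))
  other-endpoint-unique (inj₂ v≡) (inj₂ x≡) x≢v _        _   = ⊥-elim (x≢v (trans x≡ (sym v≡)))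
  other-endpoint-unique (inj₁ v≡) (inj₂ _)  _   (inj₁ y≡) y≢v = ⊥-elim (y≢v (trans y≡ (sym v≡)))
  other-endpoint-unique (inj₂ v≡) (inj₁ _)  _   (inj₂ y≡) y≢v = ⊥-elim (y≢v (trans y≡ (sym v≡)))

module _ {a ℓ₁ ℓ₂ : Level} (O : TotalOrder a ℓ₁ ℓ₂) (G : SimpleGraph)
         (f : GraphFunction O G)
         (V-edge-unique : ∀ {v e e'} → InV O G f v e → InV O G f v e' → e ≡ e') where
  open SimpleGraph G

  vpath-to-critical-deterministic : ∀ {v w w'} ps qs →
    CriticalVertex O G f w → CriticalVertex O G f w' →
    IsVPath O G f v ps w → IsVPath O G f v qs w' → ps ≡ qs × w ≡ w'
  vpath-to-critical-deterministic [] [] _ _ (lift refl) (lift refl) = refl , refl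
  vpath-to-critical-deterministic [] ((e , _) ∷ _) w-crit _ (lift refl) ((v≺e , le) , _) =
    ⊥-elim (w-crit e v≺e le)
  vpath-to-critical-deterministic ((e , _) ∷ _) [] _ w'-crit ((v≺e , le) , _) (lift refl) =
    ⊥-elim (w'-crit e v≺e le)
  vpath-to-critical-deterministic ((e , x) ∷ ps) ((e' , y) ∷ qs) w-crit w'-crit
      (ve , x≺e , x≢v , rest) (ve' , y≺e' , y≢v , rest')
    with V-edge-unique ve ve'
  ... | refl with other-endpoint-unique G (proj₁ ve) x≺e x≢v y≺e' y≢v
  ... | refl with vpath-to-critical-deterministic ps qs w-crit w'-crit rest rest'
  ... | refl , w≡w' = refl , w≡w'

  critical-target-unique : ∀ {v w w'} →
    CriticalVertex O G f w → CriticalVertex O G f w' →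
    VPathExists O G f v w → VPathExists O G f v w' → w ≡ w'
  critical-target-unique w-crit w'-crit (ps , p) (qs , q) =
    proj₂ (vpath-to-critical-deterministic ps qs w-crit w'-crit p q)

  vpath-to-critical-unique : ∀ {v w} → CriticalVertex O G f w → UniqueVPath O G f v w
  vpath-to-critical-unique w-crit ps qs p q =
    proj₁ (vpath-to-critical-deterministic ps qs w-crit w-crit p q)

V-edge-unique : ∀ {a ℓ₁ ℓ₂} (O : TotalOrder a ℓ₁ ℓ₂) (G : SimpleGraph) (f : GraphFunction O G) →
  IsDiscreteMorse O G f → ∀ {v e e'} → InV O G f v e → InV O G f v e' → e ≡ e'
V-edge-unique _ _ _ morse (v≺e , le) (v≺e' , le') = proj₁ morse _ _ _ v≺e v≺e' le le'

proposition4p5 : ∀ {a ℓ₁ ℓ₂ : Level} (O : TotalOrder a ℓ₁ ℓ₂) (G : SimpleGraph)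
    (f₁ f₂ : GraphFunction O G) →
    IsDiscreteMorse O G f₁ → IsDiscreteMorse O G f₂ →
    IsExcellent O G f₁ → IsExcellent O G f₂ →
    (v₁ v₂ : SimpleGraph.Vertex G) →
    Critical O G f₁ (inj₁ v₁) → Critical O G f₂ (inj₁ v₂) →
    StronglyConnected O G f₁ f₂ v₁ v₂ →
    ((w : SimpleGraph.Vertex G) → Critical O G f₂ (inj₁ w) →
       StronglyConnected O G f₁ f₂ v₁ w → w ≡ v₂)
    × ((u : SimpleGraph.Vertex G) → Critical O G f₁ (inj₁ u) →
       StronglyConnected O G f₁ f₂ u v₂ → u ≡ v₁)
    × UniqueVPath O G f₂ v₁ v₂
    × UniqueVPath O G f₁ v₂ v₁
proposition4p5 O G f₁ f₂ morse₁ morse₂ _ _ v₁ v₂ v₁-crit v₂-crit (v₁⇝v₂ , v₂⇝v₁) =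
    (λ w w-crit (v₁⇝w , _) → critical-target-unique O G f₂ unique₂ w-crit v₂-crit v₁⇝w v₁⇝v₂)
  , (λ u u-crit (_ , v₂⇝u) → critical-target-unique O G f₁ unique₁ u-crit v₁-crit v₂⇝u v₂⇝v₁)
  , vpath-to-critical-unique O G f₂ unique₂ v₂-crit
  , vpath-to-critical-unique O G f₁ unique₁ v₁-crit
  where
  unique₁ : ∀ {v e e'} → InV O G f₁ v e → InV O G f₁ v e' → e ≡ e'
  unique₁ = V-edge-unique O G f₁ morse₁
  unique₂ : ∀ {v e e'} → InV O G f₂ v e → InV O G f₂ v e' → e ≡ e'
  unique₂ = V-edge-unique O G f₂ morse₂
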